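{- Let $G$ be a connected $C_4$-free graph of order $n$ and minimum degree $\delta$, let $u$ be a vertex of $G$, and let $X(u)=(n_0,n_1,\ldots,n_d)$ be its distance degree. Then: (C1) $n_0=1$; (C2) $\sum_{i=0}^\infty n_i=n$; (C3) if $n_i\ge1$, then $n_1,\ldots,n_{i-1}\ge 1$; (C4) for all $i\in\{0,1,\ldots,d\}$ with $i\equiv 0\pmod 5$, $n_{i-2}+n_{i-1}+n_i+n_{i+1}+n_{i+2}\ge \delta^*$, where $\delta^*=\delta^2-2\lfloor\delta/2\rfloor+1$.
   Context: $C_4$-free means containing no 4-cycle as a (not necessarily induced) subgraph. The distance degree of $u$ with eccentricity $d$ is $(n_0,\ldots,n_d)$, where $n_i$ is the number of vertices at distance exactly $i$ from $u$; by convention $n_i=0$ for $i<0$ or $i>d$. -}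

module Defs where

open import Data.Nat using (ℕ; zero; suc; _+_; _*_; _∸_; _/_; _≤_)
open import Data.Integer using (ℤ; +_; -[1+_])
open import Data.Bool using (Bool; true; false; _∧_; _∨_; not; if_then_else_)
open import Data.Fin using (Fin)
open import Data.Fin.Properties using (_≟_)
open import Data.List using (List; map; allFin)
open import Data.Nat.ListAction using (sum)
open import Data.Bool.ListAction using (any)
open import Relation.Nullary.Decidable using (⌊_⌋)
open import Relation.Binary.PropositionalEquality using (_≡_; _≢_)
open import Data.Product using (Σ; ∃; _×_)
open import Relation.Nullary using (¬_)

record Graph (n : ℕ) : Set where
  field
    adj   : Fin n → Fin n → Bool
    sym   : ∀ u v → adj u v ≡ adj v u
    irrefl : ∀ u → adj u u ≡ false
open Graph public

count : ∀ {n} → (Fin n → Bool) → ℕ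
count {n} P = sum (map (λ v → if P v then 1 else 0) (allFin n))

degree : ∀ {n} → Graph n → Fin n → ℕ
degree G v = count (adj G v)

IsMinDegree : ∀ {n} → Graph n → ℕ → Set
IsMinDegree G δ = (∀ v → δ ≤ degree G v) × ∃ λ v → degree G v ≡ δ

-- reach G k u v = true  iff  there is a walk from u to v of length ≤ k
reach : ∀ {n} → Graph n → ℕ → Fin n → Fin n → Bool
reach G zero u v = ⌊ u ≟ v ⌋
reach {n} G (suc k) u v = reach G k u v ∨ any (λ w → reach G k u w ∧ adj G w v) (allFin n)

Connected : ∀ {n} → Graph n → Set
Connected G = ∀ u v → ∃ λ k → reach G k u v ≡ true

C4Free : ∀ {n} → Graph n → Set
C4Free G = ∀ a b c d → a ≢ b → a ≢ c → a ≢ d → b ≢ c → b ≢ d → c ≢ d →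
  ¬ (adj G a b ≡ true × adj G b c ≡ true × adj G c d ≡ true × adj G d a ≡ true)

distIs : ∀ {n} → Graph n → ℕ → Fin n → Fin n → Bool
distIs G zero u v = reach G zero u v
distIs G (suc i) u v = reach G (suc i) u v ∧ not (reach G i u v)

distDeg : ∀ {n} → Graph n → Fin n → ℕ → ℕ
distDeg G u i = count (distIs G i u)

-- n_i for integer indices, with n_i = 0 for i < 0
distDegℤ : ∀ {n} → Graph n → Fin n → ℤ → ℕ
distDegℤ G u (+ i) = distDeg G u i
distDegℤ G u -[1+ _ ] = 0

IsEccentricity : ∀ {n} → Graph n → Fin n → ℕ → Set
IsEccentricity G u d = (∀ v → reach G d u v ≡ true) × ∃ λ v → distIs G d u v ≡ true

sumTo : ℕ → (ℕ → ℕ) → ℕ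
sumTo zero f = f 0
sumTo (suc m) f = sumTo m f + f (suc m)

δstar : ℕ → ℕ
δstar δ = δ * δ ∸ 2 * (δ / 2) + 1

-- The shells {w : d(u,w) = i} partition the vertices within the eccentricity, and a vertex at
-- distance i > 0 has a neighbour at distance i − 1; this gives (C1)–(C3).
-- For (C4) pick v at distance i from u. Every vertex within distance 2 of v lies at distance
-- i − 2, …, i + 2 from u, so the five-term sum is at least |N₂[v]|. In a C₄-free graph two
-- distinct vertices have at most one common neighbour, so double counting
-- Σ_{x ∼ v} deg x = Σ_w codeg(v, w) gives deg(v) δ + 1 ≤ |N₂[v]| + 2e(N(v)); moreover N(v)
-- induces a matching, so 2e(N(v)) is an even number at most deg v. With δ ≤ deg v this forces
-- |N₂[v]| ≥ δ² − 2⌊δ/2⌋ + 1.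

module Submission where

open import Defs hiding (sym)
open import Data.Nat using (ℕ; zero; suc; _+_; _*_; _∸_; _/_; _≤_; _<_; _≤′_; ≤′-refl; ≤′-step; z≤n; s≤s; s≤s⁻¹)
open import Data.Nat.Properties hiding (_≟_; suc-injective)
open import Data.Nat.DivMod using (m*n/n≡m; /-monoˡ-≤; +-distrib-/-∣ʳ; m/n*n≤m)
open import Data.Nat.Divisibility using (_∣_; divides)
open import Data.Nat.ListAction using (sum)
open import Data.Nat.Tactic.RingSolver using (solve-∀)
open import Data.Bool using (Bool; true; false; _∧_; _∨_; not; if_then_else_)
open import Data.Bool.ListAction using (any)
open import Data.Bool.Properties as Bool using (∨-zeroʳ; ∧-idem; ∧-identityʳ; ¬-not)
open import Data.Integer using (ℤ; +_; -[1+_]; _-_)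
open import Data.Fin using (Fin; zero; suc)
open import Data.Fin.Properties using (_≟_; suc-injective)
open import Data.List using (List; []; _∷_; map; allFin)
open import Data.List.Properties using (map-tabulate; map-cong)
open import Data.List.Membership.Propositional using (_∈_)
open import Data.List.Membership.Propositional.Properties using (∈-allFin)
open import Data.List.Relation.Unary.Any using (here; there)
open import Data.Product using (∃; _×_; _,_; proj₁; proj₂)
open import Data.Sum as Sum using (_⊎_; inj₁; inj₂)
open import Data.Empty using (⊥; ⊥-elim)
open import Function using (_∘_; id)
open import Relation.Nullary.Decidable using (Dec; ⌊_⌋; yes; no; dec-true; isYes≗does)
open import Relation.Binary.PropositionalEquality
open import Algebra.Properties.Semiring.Sum +-*-semiring
  using (sum-syntax; ∑-distrib-+; ∑-comm; *-distribˡ-sum; *-distribʳ-sum; sum-cong-≗; sum-replicate-zero)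

ind : Bool → ℕ
ind b = if b then 1 else 0

ind-mono : ∀ {a b} → (a ≡ true → b ≡ true) → ind a ≤ ind b
ind-mono {false} _ = z≤n
ind-mono {true} a⇒b rewrite a⇒b refl = ≤-refl

ind-∨ : ∀ a b → ind (a ∨ b) ≤ ind a + ind b
ind-∨ false b = ≤-refl
ind-∨ true b = s≤s z≤n

ind-∧ : ∀ a b → ind (a ∧ b) ≡ ind a * ind b
ind-∧ false b = refl
ind-∧ true b = sym (+-identityʳ (ind b))

ind-split : ∀ {a b} → (a ≡ true → b ≡ true) → ind b ≡ ind a + ind (b ∧ not a)
ind-split {true} a⇒b rewrite a⇒b refl = refl
ind-split {false} {b} _ = cong ind (sym (∧-identityʳ b))

∧-true⁻¹ : ∀ {a b} → a ∧ b ≡ true → a ≡ true × b ≡ true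
∧-true⁻¹ {true} {true} _ = refl , refl

≟⇒≡ : ∀ {n} {x y : Fin n} → ⌊ x ≟ y ⌋ ≡ true → x ≡ y
≟⇒≡ {x = x} {y} eq with x ≟ y
... | yes x≡y = x≡y
≟⇒≡ () | no _

≟-refl : ∀ {n} (x : Fin n) → ⌊ x ≟ x ⌋ ≡ true
≟-refl x = trans (isYes≗does (x ≟ x)) (dec-true (x ≟ x) refl)

∈⇒any : ∀ {A : Set} {p : A → Bool} {x xs} → x ∈ xs → p x ≡ true → any p xs ≡ true
∈⇒any (here refl) px rewrite px = refl
∈⇒any {p = p} (there {x = y} x∈xs) px = trans (cong (p y ∨_) (∈⇒any x∈xs px)) (∨-zeroʳ (p y))

any⇒∃ : ∀ {A : Set} {p : A → Bool} xs → any p xs ≡ true → ∃ λ x → p x ≡ true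
any⇒∃ {p = p} (x ∷ xs) any≡true with p x in px
... | true = x , px
... | false = any⇒∃ xs any≡true

∑-mono : ∀ {n} {f g : Fin n → ℕ} → (∀ i → f i ≤ g i) → ∑[ i < n ] f i ≤ ∑[ i < n ] g i
∑-mono {zero} _ = z≤n
∑-mono {suc n} f≤g = +-mono-≤ (f≤g zero) (∑-mono (f≤g ∘ suc))

∑-distrib-+₃ : ∀ {n} (f g h : Fin n → ℕ) →
  ∑[ i < n ] (f i + g i + h i) ≡ ∑[ i < n ] f i + ∑[ i < n ] g i + ∑[ i < n ] h i
∑-distrib-+₃ f g h = trans (∑-distrib-+ (λ i → f i + g i) h) (cong (_+ _) (∑-distrib-+ f g))

∑∑-even : ∀ {n} (F : Fin n → Fin n → ℕ) → (∀ x y → F x y ≡ F y x) → (∀ x → F x x ≡ 0) →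
  ∃ λ K → ∑[ x < n ] ∑[ y < n ] F x y ≡ K + K
∑∑-even {zero} _ _ _ = 0 , refl
∑∑-even {suc n} F F-sym F-diag
  with ∑∑-even (λ x y → F (suc x) (suc y)) (λ x y → F-sym (suc x) (suc y)) (F-diag ∘ suc)
... | K , inner≡K+K = A + K , (begin
    F zero zero + A + ∑[ x < n ] (F (suc x) zero + ∑[ y < n ] F (suc x) (suc y))
      ≡⟨ cong₂ (λ a b → a + A + b) (F-diag zero) (∑-distrib-+ (λ x → F (suc x) zero) _) ⟩
    A + (∑[ x < n ] F (suc x) zero + ∑[ x < n ] ∑[ y < n ] F (suc x) (suc y))
      ≡⟨ cong₂ (λ a b → A + (a + b)) (sum-cong-≗ (λ x → F-sym (suc x) zero)) inner≡K+K ⟩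
    A + (A + (K + K))
      ≡⟨ reassoc A K ⟩
    A + K + (A + K) ∎)
  where
  open ≡-Reasoning
  A : ℕ
  A = ∑[ y < n ] F zero (suc y)
  reassoc : ∀ a k → a + (a + (k + k)) ≡ a + k + (a + k)
  reassoc = solve-∀

count-suc : ∀ {n} (P : Fin (suc n) → Bool) → count P ≡ ind (P zero) + count (P ∘ suc)
count-suc P = cong (_+_ (ind (P zero))) (cong sum
  (trans (map-tabulate suc (ind ∘ P)) (sym (map-tabulate id (ind ∘ P ∘ suc)))))

count-∑ : ∀ {n} (P : Fin n → Bool) → count P ≡ ∑[ v < n ] ind (P v)
count-∑ {zero} _ = refl
count-∑ {suc n} P = trans (count-suc P) (cong (_+_ (ind (P zero))) (count-∑ (P ∘ suc)))

count-cong : ∀ {n} {P Q : Fin n → Bool} → (∀ v → P v ≡ Q v) → count P ≡ count Q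
count-cong {n} P≗Q = cong sum (map-cong (λ v → cong ind (P≗Q v)) (allFin n))

count-+-≤ : ∀ {n} {P Q R : Fin n → Bool} → (∀ v → ind (P v) + ind (Q v) ≤ ind (R v)) →
  count P + count Q ≤ count R
count-+-≤ {n} {P} {Q} {R} pointwise = begin
  count P + count Q                         ≡⟨ cong₂ _+_ (count-∑ P) (count-∑ Q) ⟩
  ∑[ v < n ] ind (P v) + ∑[ v < n ] ind (Q v) ≡⟨ ∑-distrib-+ (ind ∘ P) (ind ∘ Q) ⟨
  ∑[ v < n ] (ind (P v) + ind (Q v))        ≤⟨ ∑-mono pointwise ⟩
  ∑[ v < n ] ind (R v)                      ≡⟨ count-∑ R ⟨
  count R                                   ∎
  where open ≤-Reasoning

count-mono : ∀ {n} {P Q : Fin n → Bool} → (∀ v → P v ≡ true → Q v ≡ true) → count P ≤ count Q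
count-mono {P = P} {Q} P⇒Q = begin
  count P                ≡⟨ count-∑ P ⟩
  ∑[ v < _ ] ind (P v)   ≤⟨ ∑-mono (λ v → ind-mono (P⇒Q v)) ⟩
  ∑[ v < _ ] ind (Q v)   ≡⟨ count-∑ Q ⟨
  count Q                ∎
  where open ≤-Reasoning

count-∨-≤ : ∀ {n} (P Q : Fin n → Bool) → count (λ v → P v ∨ Q v) ≤ count P + count Q
count-∨-≤ {n} P Q = begin
  count (λ v → P v ∨ Q v)                  ≡⟨ count-∑ (λ v → P v ∨ Q v) ⟩
  ∑[ v < n ] ind (P v ∨ Q v)               ≤⟨ ∑-mono (λ v → ind-∨ (P v) (Q v)) ⟩
  ∑[ v < n ] (ind (P v) + ind (Q v))       ≡⟨ ∑-distrib-+ (ind ∘ P) (ind ∘ Q) ⟩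
  ∑[ v < n ] ind (P v) + ∑[ v < n ] ind (Q v) ≡⟨ cong₂ _+_ (count-∑ P) (count-∑ Q) ⟨
  count P + count Q                        ∎
  where open ≤-Reasoning

count-split : ∀ {n} {P Q : Fin n → Bool} → (∀ v → P v ≡ true → Q v ≡ true) →
  count Q ≡ count P + count (λ v → Q v ∧ not (P v))
count-split {n} {P} {Q} P⇒Q = begin
  count Q                                   ≡⟨ count-∑ Q ⟩
  ∑[ v < n ] ind (Q v)                      ≡⟨ sum-cong-≗ (λ v → ind-split (P⇒Q v)) ⟩
  ∑[ v < n ] (ind (P v) + ind (Q v ∧ not (P v))) ≡⟨ ∑-distrib-+ (ind ∘ P) (λ v → ind (Q v ∧ not (P v))) ⟩
  ∑[ v < n ] ind (P v) + ∑[ v < n ] ind (Q v ∧ not (P v)) ≡⟨ cong₂ _+_ (count-∑ P) (count-∑ (λ v → Q v ∧ not (P v))) ⟨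
  count P + count (λ v → Q v ∧ not (P v))   ∎
  where open ≡-Reasoning

count-false : ∀ n → count {n} (λ _ → false) ≡ 0
count-false n = trans (count-∑ {n} (λ _ → false)) (sum-replicate-zero n)

count-all : ∀ {n} {P : Fin n → Bool} → (∀ v → P v ≡ true) → count P ≡ n
count-all {zero} _ = refl
count-all {suc n} {P} all = trans (count-suc P) (cong₂ _+_ (cong ind (all zero)) (count-all (all ∘ suc)))

count-≤1 : ∀ {n} (P : Fin n → Bool) → (∀ v w → P v ≡ true → P w ≡ true → v ≡ w) → count P ≤ 1
count-≤1 {zero} _ _ = z≤n
count-≤1 {suc n} P unique rewrite count-suc P with P zero in P0
... | true = s≤s (≤-trans (count-mono none-after-zero) (≤-reflexive (count-false n)))
  where
  none-after-zero : ∀ v → P (suc v) ≡ true → false ≡ true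
  none-after-zero v P1 with () ← unique zero (suc v) P0 P1
... | false = count-≤1 (P ∘ suc) (λ v w Pv Pw → suc-injective (unique _ _ Pv Pw))

count-≥1⇒∃ : ∀ {n} (P : Fin n → Bool) → 1 ≤ count P → ∃ λ v → P v ≡ true
count-≥1⇒∃ {suc n} P c≥1 with P zero in P0 | subst (1 ≤_) (count-suc P) c≥1
... | true | _ = zero , P0
... | false | c′≥1 = let v , Pv = count-≥1⇒∃ (P ∘ suc) c′≥1 in suc v , Pv

∃⇒count-≥1 : ∀ {n} (P : Fin n → Bool) {v} → P v ≡ true → 1 ≤ count P
∃⇒count-≥1 P {zero} Pv = subst (1 ≤_) (sym (count-suc P)) (≤-trans (≤-reflexive (cong ind (sym Pv))) (m≤m+n _ _))
∃⇒count-≥1 P {suc v} Pv = subst (1 ≤_) (sym (count-suc P)) (≤-trans (∃⇒count-≥1 (P ∘ suc) Pv) (m≤n+m _ _))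

count-≤-ind : ∀ {n} {P : Fin n → Bool} {b} → count P ≤ 1 → (∀ v → P v ≡ true → b ≡ true) → count P ≤ ind b
count-≤-ind {b = true} count≤1 _ = count≤1
count-≤-ind {n} {b = false} _ P⇒false = ≤-trans (count-mono P⇒false) (≤-reflexive (count-false n))

count-≟ : ∀ {n} (v : Fin n) → count (λ w → ⌊ v ≟ w ⌋) ≡ 1
count-≟ v = ≤-antisym (count-≤1 (λ w → ⌊ v ≟ w ⌋) λ x y v≡x v≡y → trans (sym (≟⇒≡ v≡x)) (≟⇒≡ v≡y))
                      (∃⇒count-≥1 (λ w → ⌊ v ≟ w ⌋) (≟-refl v))

count-any-≤ : ∀ {n} {A : Set} (P : A → Fin n → Bool) (zs : List A) →
  count (λ w → any (λ z → P z w) zs) ≤ sum (map (count ∘ P) zs)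
count-any-≤ {n} _ [] = ≤-reflexive (count-false n)
count-any-≤ P (z ∷ zs) =
  ≤-trans (count-∨-≤ (P z) (λ w → any (λ z → P z w) zs)) (+-monoʳ-≤ (count (P z)) (count-any-≤ P zs))

-- For δ ≥ 2 write D = δ + t: then K ≤ ⌊δ/2⌋ + t, while D δ ≥ δ² + 2t.
δstar-≤ : ∀ {δ D B K} → δ ≤ D → suc D ≤ B → D * δ + 1 ≤ B + (K + K) → K + K ≤ D → δstar δ ≤ B
δstar-≤ {0} _ 1+D≤B _ _ = ≤-trans (s≤s z≤n) 1+D≤B
δstar-≤ {1} 1≤D 1+D≤B _ _ = ≤-trans (s≤s 1≤D) 1+D≤B
δstar-≤ {δ@(suc (suc _))} {D} {B} {K} δ≤D _ Dδ+1≤B+2K 2K≤D with m≤n⇒∃[o]m+o≡n δ≤D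
... | t , refl = begin
  δ * δ ∸ 2 * q + 1 ≡⟨ +-∸-comm 1 2q≤δ² ⟨
  δ * δ + 1 ∸ 2 * q ≤⟨ m≤n+o⇒m∸n≤o (δ * δ + 1) (2 * q) δ²+1≤2q+B ⟩
  B                 ∎
  where
  open ≤-Reasoning
  q : ℕ
  q = δ / 2

  2q≤δ² : 2 * q ≤ δ * δ
  2q≤δ² = ≤-trans (≤-reflexive (*-comm 2 q)) (≤-trans (m/n*n≤m δ 2) (m≤m*n δ δ))

  K≤q+t : K ≤ q + t
  K≤q+t = begin
    K                 ≡⟨ m*n/n≡m K 2 ⟨
    K * 2 / 2         ≤⟨ /-monoˡ-≤ 2 2K≤δ+2t ⟩
    (δ + t * 2) / 2   ≡⟨ +-distrib-/-∣ʳ δ (divides t refl) ⟩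
    q + t * 2 / 2     ≡⟨ cong (_+_ q) (m*n/n≡m t 2) ⟩
    q + t             ∎
    where
    double : ∀ k → k * 2 ≡ k + k
    double = solve-∀
    2K≤δ+2t : K * 2 ≤ δ + t * 2
    2K≤δ+2t = ≤-trans (≤-reflexive (double K)) (≤-trans 2K≤D (+-monoʳ-≤ δ (m≤m*n t 2)))

  δ²+1≤2q+B : δ * δ + 1 ≤ 2 * q + B
  δ²+1≤2q+B = +-cancelʳ-≤ (2 * t) _ _ (begin
    δ * δ + 1 + 2 * t       ≤⟨ +-monoʳ-≤ (δ * δ + 1) (≤-trans (≤-reflexive (*-comm 2 t)) (*-monoʳ-≤ t (s≤s (s≤s z≤n)))) ⟩
    δ * δ + 1 + t * δ       ≡⟨ expand δ t ⟩
    (δ + t) * δ + 1         ≤⟨ Dδ+1≤B+2K ⟩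
    B + (K + K)             ≤⟨ +-monoʳ-≤ B (+-mono-≤ K≤q+t K≤q+t) ⟩
    B + (q + t + (q + t))   ≡⟨ regroup B q t ⟩
    2 * q + B + 2 * t       ∎)
    where
    expand : ∀ d t → d * d + 1 + t * d ≡ (d + t) * d + 1
    expand = solve-∀
    regroup : ∀ b q t → b + (q + t + (q + t)) ≡ 2 * q + b + 2 * t
    regroup = solve-∀

near-cases : ∀ i j → j ≤ i + 2 → i ≤ j + 2 → i ≡ 2 + j ⊎ i ≡ 1 + j ⊎ i ≡ j ⊎ j ≡ i + 1 ⊎ j ≡ i + 2
near-cases 0 0 _ _ = inj₂ (inj₂ (inj₁ refl))
near-cases 0 1 _ _ = inj₂ (inj₂ (inj₂ (inj₁ refl)))
near-cases 0 2 _ _ = inj₂ (inj₂ (inj₂ (inj₂ refl)))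
near-cases 0 (suc (suc (suc _))) (s≤s (s≤s ())) _
near-cases 1 0 _ _ = inj₂ (inj₁ refl)
near-cases 2 0 _ _ = inj₁ refl
near-cases (suc (suc (suc _))) 0 _ (s≤s (s≤s ()))
near-cases (suc i) (suc j) (s≤s j≤i+2) (s≤s i≤j+2) =
  Sum.map (cong suc) (Sum.map (cong suc) (Sum.map (cong suc) (Sum.map (cong suc) (cong suc))))
    (near-cases i j j≤i+2 i≤j+2)

module Reachability {n} (G : Graph n) where

  adj-sym : ∀ {x y} → adj G x y ≡ true → adj G y x ≡ true
  adj-sym {x} {y} xy = trans (Graph.sym G y x) xy

  reach-suc : ∀ {k u v} → reach G k u v ≡ true → reach G (suc k) u v ≡ true
  reach-suc r rewrite r = refl

  reach-mono : ∀ {k m u v} → k ≤ m → reach G k u v ≡ true → reach G m u v ≡ true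
  reach-mono {k} {m} {u} {v} k≤m r = go (≤⇒≤′ k≤m)
    where
    go : ∀ {m} → k ≤′ m → reach G m u v ≡ true
    go ≤′-refl = r
    go {suc m} (≤′-step k≤′m) = reach-suc {m} (go k≤′m)

  reach-refl : ∀ k v → reach G k v v ≡ true
  reach-refl k v = reach-mono {0} {k} z≤n (≟-refl v)

  reach-step : ∀ {k u w v} → reach G k u w ≡ true → adj G w v ≡ true → reach G (suc k) u v ≡ true
  reach-step {k} {u} {w} {v} r wv =
    trans (cong (reach G k u v ∨_) (∈⇒any (∈-allFin w) (cong₂ _∧_ r wv))) (∨-zeroʳ (reach G k u v))

  reach-adj : ∀ {u v} → adj G u v ≡ true → reach G 1 u v ≡ true
  reach-adj {u} = reach-step {0} {u} (reach-refl 0 u)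

  reach-suc⁻¹ : ∀ {k u v} → reach G (suc k) u v ≡ true →
    reach G k u v ≡ true ⊎ ∃ λ w → reach G k u w ≡ true × adj G w v ≡ true
  reach-suc⁻¹ {k} {u} {v} r with reach G k u v
  ... | true = inj₁ refl
  ... | false = let w , rw = any⇒∃ (allFin n) r in inj₂ (w , ∧-true⁻¹ rw)

  reach-trans : ∀ {j k u v w} → reach G j u v ≡ true → reach G k v w ≡ true → reach G (j + k) u w ≡ true
  reach-trans {j} {zero} r₁ r₂ with ≟⇒≡ r₂
  ... | refl = subst (λ m → reach G m _ _ ≡ true) (sym (+-identityʳ j)) r₁
  reach-trans {j} {suc k} {u} {v} {w} r₁ r₂ =
    subst (λ m → reach G m u w ≡ true) (sym (+-suc j k)) (extend (reach-suc⁻¹ {k} r₂))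
    where
    extend : reach G k v w ≡ true ⊎ ∃ (λ x → reach G k v x ≡ true × adj G x w ≡ true) →
      reach G (suc (j + k)) u w ≡ true
    extend (inj₁ r) = reach-suc {j + k} (reach-trans {j} {k} r₁ r)
    extend (inj₂ (x , r , a)) = reach-step {j + k} (reach-trans {j} {k} r₁ r) a

  reach-sym : ∀ {k v w} → reach G k v w ≡ true → reach G k w v ≡ true
  reach-sym {zero} r with ≟⇒≡ r
  ... | refl = r
  reach-sym {suc k} r with reach-suc⁻¹ {k} r
  ... | inj₁ r′ = reach-suc {k} (reach-sym {k} r′)
  ... | inj₂ (x , r′ , a) = reach-trans {1} {k} (reach-adj (adj-sym a)) (reach-sym {k} r′)

  distIs⇒reach : ∀ {i u v} → distIs G i u v ≡ true → reach G i u v ≡ true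
  distIs⇒reach {zero} d = d
  distIs⇒reach {suc i} d = proj₁ (∧-true⁻¹ d)

  distIs-minimal : ∀ {i m u v} → distIs G i u v ≡ true → reach G m u v ≡ true → i ≤ m
  distIs-minimal {zero} _ _ = z≤n
  distIs-minimal {suc i} {m} d r = ≮⇒≥ λ m≤i → not-both (reach-mono {m} {i} (s≤s⁻¹ m≤i) r) (proj₂ (∧-true⁻¹ d))
    where
    not-both : ∀ {b} → b ≡ true → not b ≡ true → ⊥
    not-both refl ()

  distance-exists : ∀ {m u v} → reach G m u v ≡ true → ∃ λ j → j ≤ m × distIs G j u v ≡ true
  distance-exists {zero} r = 0 , z≤n , r
  distance-exists {suc m} {u} {v} r with reach G m u v Bool.≟ true
  ... | yes rm = let j , j≤m , d = distance-exists {m} rm in j , m≤n⇒m≤1+n j≤m , d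
  ... | no ¬rm = suc m , ≤-refl , cong₂ _∧_ r (cong not (¬-not ¬rm))

  distIs-pred : ∀ {k u v} → distIs G (suc k) u v ≡ true → ∃ λ w → distIs G k u w ≡ true
  distIs-pred {k} {u} {v} d with reach-suc⁻¹ {k} (distIs⇒reach {suc k} d)
  ... | inj₁ r = ⊥-elim (1+n≰n (distIs-minimal {suc k} d r))
  ... | inj₂ (w , r , a) with distance-exists {k} r
  ...   | j , j≤k , dj = w , subst (λ i → distIs G i u w ≡ true) (≤-antisym j≤k k≤j) dj
    where
    k≤j : k ≤ j
    k≤j = s≤s⁻¹ (distIs-minimal {suc k} d (reach-step {j} (distIs⇒reach {j} dj) a))

  distIs-down : ∀ {i j u v} → distIs G i u v ≡ true → j ≤ i → ∃ λ w → distIs G j u w ≡ true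
  distIs-down {i} {j} {u} {v} d j≤i = go (≤⇒≤′ j≤i) d
    where
    go : ∀ {i v} → j ≤′ i → distIs G i u v ≡ true → ∃ λ w → distIs G j u w ≡ true
    go ≤′-refl d = _ , d
    go {suc i} (≤′-step j≤′i) d = let _ , d′ = distIs-pred {i} d in go j≤′i d′

  count-reach : ∀ u m → count (reach G m u) ≡ sumTo m (distDeg G u)
  count-reach u zero = refl
  count-reach u (suc m) =
    trans (count-split (λ v → reach-suc {m} {u} {v})) (cong (_+ distDeg G u (suc m)) (count-reach u m))

module Codegree {n} (G : Graph n) where
  open Reachability G

  adj⇒≢ : ∀ {x y} → adj G x y ≡ true → x ≢ y
  adj⇒≢ {x} xy refl with () ← trans (sym xy) (irrefl G x)

  codegree : Fin n → Fin n → ℕ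
  codegree v w = count (λ x → adj G v x ∧ adj G x w)

  ball₂ : Fin n → ℕ
  ball₂ v = count (reach G 2 v)

  -- The number of ordered pairs of adjacent neighbours of v, i.e. twice the number of edges inside N(v).
  neighbourhoodArcs : Fin n → ℕ
  neighbourhoodArcs v = ∑[ w < n ] (ind (adj G v w) * codegree v w)

  codegree-self : ∀ v → codegree v v ≡ degree G v
  codegree-self v = count-cong λ x → trans (cong (adj G v x ∧_) (Graph.sym G x v)) (∧-idem (adj G v x))

  codegree-≤1 : C4Free G → ∀ {v w} → v ≢ w → codegree v w ≤ 1
  codegree-≤1 c4 {v} {w} v≢w = count-≤1 (λ x → adj G v x ∧ adj G x w) unique
    where
    unique : ∀ x y → adj G v x ∧ adj G x w ≡ true → adj G v y ∧ adj G y w ≡ true → x ≡ y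
    unique x y vxw vyw with x ≟ y | ∧-true⁻¹ vxw | ∧-true⁻¹ vyw
    ... | yes x≡y | _ | _ = x≡y
    ... | no x≢y | vx , xw | vy , yw = ⊥-elim (c4 v x w y
      (adj⇒≢ vx) v≢w (adj⇒≢ vy) (adj⇒≢ xw) x≢y (adj⇒≢ (adj-sym yw)) (vx , xw , adj-sym yw , adj-sym vy))

  ∑-codegree : ∀ v → ∑[ w < n ] codegree v w ≡ ∑[ x < n ] (ind (adj G v x) * degree G x)
  ∑-codegree v = begin
    ∑[ w < n ] codegree v w
      ≡⟨ sum-cong-≗ (λ w → count-∑ (λ x → adj G v x ∧ adj G x w)) ⟩
    ∑[ w < n ] ∑[ x < n ] ind (adj G v x ∧ adj G x w)
      ≡⟨ ∑-comm (λ w x → ind (adj G v x ∧ adj G x w)) ⟩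
    ∑[ x < n ] ∑[ w < n ] ind (adj G v x ∧ adj G x w)
      ≡⟨ sum-cong-≗ (λ x → sum-cong-≗ (λ w → ind-∧ (adj G v x) (adj G x w))) ⟩
    ∑[ x < n ] ∑[ w < n ] (ind (adj G v x) * ind (adj G x w))
      ≡⟨ sum-cong-≗ (λ x → *-distribˡ-sum (ind (adj G v x)) (ind ∘ adj G x)) ⟨
    ∑[ x < n ] (ind (adj G v x) * ∑[ w < n ] ind (adj G x w))
      ≡⟨ sum-cong-≗ (λ x → cong (_*_ (ind (adj G v x))) (count-∑ (adj G x))) ⟨
    ∑[ x < n ] (ind (adj G v x) * degree G x) ∎
    where open ≡-Reasoning

  degree*δ≤∑codegree : ∀ {δ} → (∀ x → δ ≤ degree G x) → ∀ v → degree G v * δ ≤ ∑[ w < n ] codegree v w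
  degree*δ≤∑codegree {δ} δ≤deg v = begin
    degree G v * δ                          ≡⟨ cong (_* δ) (count-∑ (adj G v)) ⟩
    (∑[ x < n ] ind (adj G v x)) * δ        ≡⟨ *-distribʳ-sum δ (ind ∘ adj G v) ⟩
    ∑[ x < n ] (ind (adj G v x) * δ)         ≤⟨ ∑-mono (λ x → *-monoʳ-≤ (ind (adj G v x)) (δ≤deg x)) ⟩
    ∑[ x < n ] (ind (adj G v x) * degree G x) ≡⟨ ∑-codegree v ⟨
    ∑[ w < n ] codegree v w                 ∎
    where open ≤-Reasoning

  codegree≤reach₂ : C4Free G → ∀ {v w} → v ≢ w → codegree v w ≤ ind (reach G 2 v w)
  codegree≤reach₂ c4 {v} {w} v≢w = count-≤-ind {P = λ x → adj G v x ∧ adj G x w} (codegree-≤1 c4 v≢w)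
    λ x vxw → let vx , xw = ∧-true⁻¹ vxw in reach-step {1} (reach-adj vx) xw

  codegree-split : C4Free G → ∀ v w →
    codegree v w + ind ⌊ v ≟ w ⌋ + ind (adj G v w)
      ≤ ind (reach G 2 v w) + degree G v * ind ⌊ v ≟ w ⌋ + ind (adj G v w) * codegree v w
  codegree-split c4 v w = by-cases (v ≟ w)
    where
    -- Casing on `v ≟ w` with `with` would also rewrite the copy hidden inside `reach G 2 v w`.
    by-cases : ∀ {v w} (v≟w : Dec (v ≡ w)) →
      codegree v w + ind ⌊ v≟w ⌋ + ind (adj G v w)
        ≤ ind (reach G 2 v w) + degree G v * ind ⌊ v≟w ⌋ + ind (adj G v w) * codegree v w
    by-cases {v} (yes refl) = ≤-reflexive (begin
      codegree v v + 1 + ind (adj G v v)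
        ≡⟨ cong₂ (λ c a → c + 1 + ind a) (codegree-self v) (irrefl G v) ⟩
      degree G v + 1 + 0
        ≡⟨ self (degree G v) ⟩
      1 + degree G v * 1 + 0
        ≡⟨ cong₂ (λ r a → ind r + degree G v * 1 + ind a * codegree v v) (reach-refl 2 v) (irrefl G v) ⟨
      ind (reach G 2 v v) + degree G v * 1 + ind (adj G v v) * codegree v v ∎)
      where
      open ≡-Reasoning
      self : ∀ d → d + 1 + 0 ≡ 1 + d * 1 + 0
      self = solve-∀
    by-cases {v} {w} (no v≢w) = not-self (adj G v w) refl
      where
      not-self : ∀ a → adj G v w ≡ a →
        codegree v w + 0 + ind a ≤ ind (reach G 2 v w) + degree G v * 0 + ind a * codegree v w
      not-self true vw = begin
        codegree v w + 0 + 1                   ≡⟨ adjacent (codegree v w) ⟩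
        1 + 1 * codegree v w                   ≤⟨ +-monoˡ-≤ (1 * codegree v w) (ind-mono {true} λ _ → reach-suc {1} (reach-adj vw)) ⟩
        ind (reach G 2 v w) + 1 * codegree v w ≤⟨ +-monoˡ-≤ (1 * codegree v w) (m≤m+n (ind (reach G 2 v w)) _) ⟩
        ind (reach G 2 v w) + degree G v * 0 + 1 * codegree v w ∎
        where
        open ≤-Reasoning
        adjacent : ∀ c → c + 0 + 1 ≡ 1 + 1 * c
        adjacent = solve-∀
      not-self false _ = begin
        codegree v w + 0 + 0                     ≡⟨ trans (+-identityʳ _) (+-identityʳ _) ⟩
        codegree v w                             ≤⟨ codegree≤reach₂ c4 v≢w ⟩
        ind (reach G 2 v w)                      ≤⟨ ≤-trans (m≤m+n _ _) (m≤m+n _ _) ⟩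
        ind (reach G 2 v w) + degree G v * 0 + 0 ∎
        where open ≤-Reasoning

  closed-neighbourhood⊆ball₂ : ∀ v w → ind ⌊ v ≟ w ⌋ + ind (adj G v w) ≤ ind (reach G 2 v w)
  closed-neighbourhood⊆ball₂ v w = by-cases (v ≟ w)
    where
    by-cases : ∀ {v w} (v≟w : Dec (v ≡ w)) → ind ⌊ v≟w ⌋ + ind (adj G v w) ≤ ind (reach G 2 v w)
    by-cases {v} (yes refl) = subst₂ (λ a r → 1 + ind a ≤ ind r) (sym (irrefl G v)) (sym (reach-refl 2 v)) ≤-refl
    by-cases (no _) = ind-mono (λ vw → reach-suc {1} (reach-adj vw))

  suc-degree≤ball₂ : ∀ v → suc (degree G v) ≤ ball₂ v
  suc-degree≤ball₂ v = subst (λ c → c + degree G v ≤ ball₂ v) (count-≟ v)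
    (count-+-≤ {P = λ w → ⌊ v ≟ w ⌋} {adj G v} {reach G 2 v} (closed-neighbourhood⊆ball₂ v))

  neighbourhoodArcs-even : ∀ v → ∃ λ K → neighbourhoodArcs v ≡ K + K
  neighbourhoodArcs-even v = let K , ∑∑F≡K+K = ∑∑-even F F-sym F-diag in K , trans (sum-cong-≗ row) ∑∑F≡K+K
    where
    F : Fin n → Fin n → ℕ
    F w x = ind (adj G v w) * ind (adj G v x) * ind (adj G x w)
    F-sym : ∀ w x → F w x ≡ F x w
    F-sym w x = cong₂ _*_ (*-comm (ind (adj G v w)) (ind (adj G v x))) (cong ind (Graph.sym G x w))
    F-diag : ∀ w → F w w ≡ 0
    F-diag w = trans (cong (λ a → ind (adj G v w) * ind (adj G v w) * ind a) (irrefl G w))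
                     (*-zeroʳ (ind (adj G v w) * ind (adj G v w)))
    row : ∀ w → ind (adj G v w) * codegree v w ≡ ∑[ x < n ] F w x
    row w = begin
      ind (adj G v w) * codegree v w
        ≡⟨ cong (_*_ (ind (adj G v w))) (count-∑ (λ x → adj G v x ∧ adj G x w)) ⟩
      ind (adj G v w) * ∑[ x < n ] ind (adj G v x ∧ adj G x w)
        ≡⟨ *-distribˡ-sum (ind (adj G v w)) (λ x → ind (adj G v x ∧ adj G x w)) ⟩
      ∑[ x < n ] (ind (adj G v w) * ind (adj G v x ∧ adj G x w))
        ≡⟨ sum-cong-≗ (λ x → trans (cong (_*_ (ind (adj G v w))) (ind-∧ (adj G v x) (adj G x w)))
                                   (sym (*-assoc (ind (adj G v w)) _ _))) ⟩
      ∑[ x < n ] F w x ∎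
      where open ≡-Reasoning

  neighbourhoodArcs-≤ : C4Free G → ∀ v → neighbourhoodArcs v ≤ degree G v
  neighbourhoodArcs-≤ c4 v = begin
    neighbourhoodArcs v         ≤⟨ ∑-mono (λ w → at-most-one (adj G v w) refl) ⟩
    ∑[ w < n ] ind (adj G v w)  ≡⟨ count-∑ (adj G v) ⟨
    degree G v                  ∎
    where
    open ≤-Reasoning
    at-most-one : ∀ {w} a → adj G v w ≡ a → ind a * codegree v w ≤ ind a
    at-most-one true vw = ≤-trans (≤-reflexive (+-identityʳ _)) (codegree-≤1 c4 (adj⇒≢ vw))
    at-most-one false _ = z≤n

  degree*δ+1≤ball₂+arcs : C4Free G → ∀ {δ} → (∀ x → δ ≤ degree G x) → ∀ v →
    degree G v * δ + 1 ≤ ball₂ v + neighbourhoodArcs v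
  degree*δ+1≤ball₂+arcs c4 {δ} δ≤deg v = +-cancelʳ-≤ D _ _ (begin
    D * δ + 1 + D
      ≤⟨ +-monoˡ-≤ D (+-monoˡ-≤ 1 (degree*δ≤∑codegree δ≤deg v)) ⟩
    ∑[ w < n ] codegree v w + 1 + D
      ≡⟨ cong₂ (λ a b → ∑[ w < n ] codegree v w + a + b) ∑self≡1 ∑adj≡D ⟨
    ∑[ w < n ] codegree v w + ∑[ w < n ] ind ⌊ v ≟ w ⌋ + ∑[ w < n ] ind (adj G v w)
      ≡⟨ ∑-distrib-+₃ (codegree v) (λ w → ind ⌊ v ≟ w ⌋) (ind ∘ adj G v) ⟨
    ∑[ w < n ] (codegree v w + ind ⌊ v ≟ w ⌋ + ind (adj G v w))
      ≤⟨ ∑-mono (codegree-split c4 v) ⟩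
    ∑[ w < n ] (ind (reach G 2 v w) + D * ind ⌊ v ≟ w ⌋ + ind (adj G v w) * codegree v w)
      ≡⟨ ∑-distrib-+₃ (ind ∘ reach G 2 v) (λ w → D * ind ⌊ v ≟ w ⌋) (λ w → ind (adj G v w) * codegree v w) ⟩
    ∑[ w < n ] ind (reach G 2 v w) + ∑[ w < n ] (D * ind ⌊ v ≟ w ⌋) + neighbourhoodArcs v
      ≡⟨ cong₂ (λ b d → b + d + neighbourhoodArcs v) (count-∑ (reach G 2 v)) (sym ∑Dself≡D) ⟨
    ball₂ v + D + neighbourhoodArcs v
      ≡⟨ swap (ball₂ v) D (neighbourhoodArcs v) ⟩
    ball₂ v + neighbourhoodArcs v + D ∎)
    where
    open ≤-Reasoning
    D : ℕ
    D = degree G v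
    ∑self≡1 : ∑[ w < n ] ind ⌊ v ≟ w ⌋ ≡ 1
    ∑self≡1 = trans (sym (count-∑ (λ w → ⌊ v ≟ w ⌋))) (count-≟ v)
    ∑adj≡D : ∑[ w < n ] ind (adj G v w) ≡ D
    ∑adj≡D = sym (count-∑ (adj G v))
    ∑Dself≡D : ∑[ w < n ] (D * ind ⌊ v ≟ w ⌋) ≡ D
    ∑Dself≡D = trans (sym (*-distribˡ-sum D (λ w → ind ⌊ v ≟ w ⌋))) (trans (cong (_*_ D) ∑self≡1) (*-identityʳ D))
    swap : ∀ b d a → b + d + a ≡ b + a + d
    swap = solve-∀

  δstar≤ball₂ : C4Free G → ∀ {δ} → (∀ x → δ ≤ degree G x) → ∀ v → δstar δ ≤ ball₂ v
  δstar≤ball₂ c4 {δ} δ≤deg v =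
    let K , arcs≡K+K = neighbourhoodArcs-even v in
    δstar-≤ {K = K} (δ≤deg v) (suc-degree≤ball₂ v)
      (subst (λ M → degree G v * δ + 1 ≤ ball₂ v + M) arcs≡K+K (degree*δ+1≤ball₂+arcs c4 δ≤deg v))
      (subst (_≤ degree G v) arcs≡K+K (neighbourhoodArcs-≤ c4 v))

module Shells {n} (G : Graph n) (u : Fin n) where
  open Reachability G

  shell : ℤ → Fin n → Bool
  shell (+ j) = distIs G j u
  shell -[1+ _ ] _ = false

  count-shell : ∀ z → count (shell z) ≡ distDegℤ G u z
  count-shell (+ j) = refl
  count-shell -[1+ _ ] = count-false n

  window : ℕ → List ℤ
  window i = + i - + 2 ∷ + i - + 1 ∷ + i ∷ + (i + 1) ∷ + (i + 2) ∷ []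

  ∈-window : ∀ i j → j ≤ i + 2 → i ≤ j + 2 → + j ∈ window i
  ∈-window i j j≤i+2 i≤j+2 with near-cases i j j≤i+2 i≤j+2
  ... | inj₁ refl = here refl
  ... | inj₂ (inj₁ refl) = there (here refl)
  ... | inj₂ (inj₂ (inj₁ refl)) = there (there (here refl))
  ... | inj₂ (inj₂ (inj₂ (inj₁ refl))) = there (there (there (here refl)))
  ... | inj₂ (inj₂ (inj₂ (inj₂ refl))) = there (there (there (there (here refl))))

  ball₂⊆window : ∀ {i v w} → distIs G i u v ≡ true → reach G 2 v w ≡ true →
    any (λ z → shell z w) (window i) ≡ true
  ball₂⊆window {i} {v} {w} dv r with distance-exists {i + 2} (reach-trans {i} {2} (distIs⇒reach {i} dv) r)
  ... | j , j≤i+2 , dw = ∈⇒any {p = λ z → shell z w} (∈-window i j j≤i+2 i≤j+2) dw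
    where
    i≤j+2 : i ≤ j + 2
    i≤j+2 = distIs-minimal {i} dv (reach-trans {j} {2} (distIs⇒reach {j} dw) (reach-sym {2} r))

  ball₂≤window : ∀ {i v} → distIs G i u v ≡ true →
    count (reach G 2 v) ≤ distDegℤ G u (+ i - + 2) + distDegℤ G u (+ i - + 1) + distDegℤ G u (+ i)
                          + distDegℤ G u (+ (i + 1)) + distDegℤ G u (+ (i + 2))
  ball₂≤window {i} {v} dv = begin
    count (reach G 2 v)                             ≤⟨ count-mono (λ w → ball₂⊆window {i} {v} {w} dv) ⟩
    count (λ w → any (λ z → shell z w) (window i))  ≤⟨ count-any-≤ shell (window i) ⟩
    sum (map (count ∘ shell) (window i))            ≡⟨ cong sum (map-cong count-shell (window i)) ⟩
    sum (map (distDegℤ G u) (window i))             ≡⟨ unfold-sum (distDegℤ G u (+ i - + 2)) (distDegℤ G u (+ i - + 1)) _ _ _ ⟩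
    distDegℤ G u (+ i - + 2) + distDegℤ G u (+ i - + 1) + distDegℤ G u (+ i)
      + distDegℤ G u (+ (i + 1)) + distDegℤ G u (+ (i + 2)) ∎
    where
    open ≤-Reasoning
    unfold-sum : ∀ a b c d e → a + (b + (c + (d + (e + 0)))) ≡ a + b + c + d + e
    unfold-sum = solve-∀

proposition5p2 : ∀ {n} (G : Graph n) (δ : ℕ) (u : Fin n) (d : ℕ) →
    Connected G → C4Free G → IsMinDegree G δ → IsEccentricity G u d →
    (distDeg G u 0 ≡ 1)
    × (∀ m → d ≤ m → sumTo m (distDeg G u) ≡ n)
    × (∀ i → 1 ≤ distDeg G u i → ∀ j → 1 ≤ j → j < i → 1 ≤ distDeg G u j)
    × (∀ i → i ≤ d → 5 ∣ i →
         δstar δ ≤ distDegℤ G u (+ i - + 2) + distDegℤ G u (+ i - + 1) + distDegℤ G u (+ i)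
                   + distDegℤ G u (+ (i + 1)) + distDegℤ G u (+ (i + 2)))
-- Connectivity follows from the eccentricity hypothesis, and the bound (C4) holds for every i ≤ d.
proposition5p2 G δ u d _ c4 (δ≤deg , _) (reach-d , _ , dist-d) =
    count-≟ u
  , (λ m d≤m → trans (sym (count-reach u m)) (count-all (λ v → reach-mono {d} {m} d≤m (reach-d v))))
  , (λ i nᵢ≥1 j _ j<i →
       let _ , dv = count-≥1⇒∃ (distIs G i u) nᵢ≥1
           _ , dw = distIs-down {i} {j} dv (<⇒≤ j<i)
       in ∃⇒count-≥1 (distIs G j u) dw)
  , (λ i i≤d _ →
       let v , dv = distIs-down {d} {i} dist-d i≤d
       in ≤-trans (δstar≤ball₂ c4 δ≤deg v) (ball₂≤window {i} dv))
  where
  open Reachability G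
  open Codegree G
  open Shells G u
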